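{- Let $P$ be a nonempty finite set of partitions whose profile is the staircase $S=\{(p_1,[a_1,b_1]),\ldots,(p_{s+1},[a_{s+1},\infty])\}$ with $k=p_1>p_2>\cdots>p_{s+1}=0$. Then for every partition $\mu$, $\vee_P(\mu)$ (which depends only on $S$, and is also denoted $\vee_S(\mu)$) is the partition $$(\mu_{a_1}+p_1,\ldots,\mu_{b_1}+p_1,\ \mu_{a_2}+p_2,\ldots,\mu_{b_2}+p_2,\ \ldots,\ \mu_{a_{s+1}}+p_{s+1},\mu_{a_{s+1}+1}+p_{s+1},\ldots),$$ and its weight is $\sum_{i=1}^{s+1}\sum_{j=a_i}^{b_i}(\mu_j+p_i)$.
   Context: A partition is a weakly decreasing sequence $\sigma=(\sigma_1,\sigma_2,\ldots)$ of nonnegative integers with finitely many positive terms, with $\sigma_\infty=0$, indices in $[1,\infty]$; weight $|\sigma|=\sum\sigma_i$. The $p$-interval of $\sigma$ is $\{i\in[1,\infty]:\sigma_i=p\}$. For finite nonempty $P$, the profile is $\mathrm{pr}(P)=\bigcup_{p\ge0}\{(p,I):I$ inclusion-maximal among nonempty $p$-intervals of members of $P\}$. Sum: $\mu+\alpha=(\mu_1+\alpha_1,\mu_2+\alpha_2,\ldots)$. $\alpha\vee\beta$ is the partition in which each positive integer has multiplicity equal to the maximum of its multiplicities in $\alpha$ and $\beta$; $\vee_P(\mu)=(\mu+\alpha^{(1)})\vee\cdots\vee(\mu+\alpha^{(s)})$ for $P=\{\alpha^{(1)},\ldots,\alpha^{(s)}\}$. A staircase is a set $\{(p_1,[a_1,b_1]),\ldots,(p_{s+1},[a_{s+1},b_{s+1}])\}$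 with $p_1>\cdots>p_{s+1}=0$, $p_1>0$, $a_1=1$, $a_2\ne1$, $a_i\le b_i$, $b_{s+1}=\infty$, and for $i\ge2$, $a_i\in\{b_{i-1},b_{i-1}+1\}$. -}

module Defs where

open import Data.Nat using (ℕ; zero; suc; _+_; _∸_; _≤_; _<_; _⊔_; _<ᵇ_; _≟_)
open import Data.Bool using (if_then_else_)
open import Data.Nat.ListAction using (sum)
open import Data.List using (List; []; _∷_; map; foldr; length; filter; replicate; _++_; upTo; drop)
open import Data.List.Relation.Unary.All using (All)
open import Data.List.Relation.Unary.Linked using (Linked)
open import Data.List.Membership.Propositional using (_∈_)
open import Data.Product using (Σ; _×_; _,_; proj₁)
open import Data.Sum using (_⊎_)
open import Data.Empty using (⊥)
open import Data.Unit using (⊤)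
open import Relation.Binary.PropositionalEquality using (_≡_; _≢_)

-- Partitions, represented by the list of their positive parts
-- (σ₁ ≥ σ₂ ≥ … ≥ σ_ℓ > 0); all further parts (and σ_∞) are 0.

IsPartition : List ℕ → Set
IsPartition σ = Linked (λ x y → y ≤ x) σ × All (λ x → 0 < x) σ

-- σ at 0-based position n, i.e. the part σ_{n+1} (0 beyond the length)
at : List ℕ → ℕ → ℕ
at []       _       = 0
at (x ∷ _)  zero    = x
at (_ ∷ xs) (suc n) = at xs n

weight : List ℕ → ℕ
weight = sum

_⊕_ : List ℕ → List ℕ → List ℕ
[]       ⊕ ys       = ys
(x ∷ xs) ⊕ []       = x ∷ xs
(x ∷ xs) ⊕ (y ∷ ys) = (x + y) ∷ (xs ⊕ ys)

mult : ℕ → List ℕ → ℕ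
mult m σ = length (filter (m ≟_) σ)

fromMult : ℕ → (ℕ → ℕ) → List ℕ
fromMult zero    f = []
fromMult (suc n) f = replicate (f (suc n)) (suc n) ++ fromMult n f

maxPart : List ℕ → ℕ
maxPart = foldr _⊔_ 0

_∨_ : List ℕ → List ℕ → List ℕ
α ∨ β = fromMult (maxPart α ⊔ maxPart β) (λ m → mult m α ⊔ mult m β)

-- ∨_P(μ) = (μ + α⁽¹⁾) ∨ ⋯ ∨ (μ + α⁽ˢ⁾)   (the empty partition is the unit of ∨)
veeP : List (List ℕ) → List ℕ → List ℕ
veeP P μ = foldr (λ α acc → (μ ⊕ α) ∨ acc) [] P

-- Indices in [1,∞]:  ix n denotes the index n+1, and ∞ the index ∞.

data Idx : Set where
  ix : ℕ → Idx
  ∞  : Idx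

data _≤I_ : Idx → Idx → Set where
  ix≤ix : ∀ {m n} → m ≤ n → ix m ≤I ix n
  _≤∞   : ∀ i → i ≤I ∞

sucI : Idx → Idx
sucI (ix n) = ix (suc n)
sucI ∞      = ∞

val : List ℕ → Idx → ℕ
val σ (ix n) = at σ n
val σ ∞      = 0

IdxSet : Set₁
IdxSet = Idx → Set

_⊆_ : IdxSet → IdxSet → Set
I ⊆ J = ∀ i → I i → J i

_≐_ : IdxSet → IdxSet → Set
I ≐ J = I ⊆ J × J ⊆ I

NonEmpty : IdxSet → Set
NonEmpty I = Σ Idx I

Interval : Idx → Idx → IdxSet
Interval a b i = a ≤I i × i ≤I b

pInt : List ℕ → ℕ → IdxSet
pInt σ p i = val σ i ≡ p

InProfile : List (List ℕ) → ℕ → IdxSet → Set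
InProfile P p I =
  Σ (List ℕ) λ σ → σ ∈ P × I ≐ pInt σ p × NonEmpty I ×
    (∀ τ → τ ∈ P → NonEmpty (pInt τ p) → I ⊆ pInt τ p → pInt τ p ⊆ I)

-- Staircases, as the list of steps (p₁,a₁,b₁), …, (p_{s+1},a_{s+1},b_{s+1})

Step : Set
Step = ℕ × Idx × Idx

InSteps : List Step → ℕ → IdxSet → Set
InSteps S p I = Σ Step λ { (q , a , b) → (q , a , b) ∈ S × p ≡ q × I ≐ Interval a b }

ProfileIs : List (List ℕ) → List Step → Set₁
ProfileIs P S = ∀ p (I : IdxSet) → (InProfile P p I → InSteps S p I) × (InSteps S p I → InProfile P p I)

-- conditions on the steps following step (p , _ , b)
StairTail : ℕ → Idx → List Step → Set
StairTail p b []                   = p ≡ 0 × b ≡ ∞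
StairTail p b ((p' , a' , b') ∷ S) = p' < p × (a' ≡ b ⊎ a' ≡ sucI b) × a' ≤I b' × StairTail p' b' S

SecondNot1 : List Step → Set
SecondNot1 []                = ⊤
SecondNot1 ((_ , a , _) ∷ _) = a ≢ ix 0

IsStaircase : List Step → Set
IsStaircase []                = ⊥
IsStaircase ((p , a , b) ∷ S) = 0 < p × a ≡ ix 0 × a ≤I b × StairTail p b S × SecondNot1 S

-- The sequence (μ_{a₁}+p₁,…,μ_{b₁}+p₁, μ_{a₂}+p₂,…, μ_{a_{s+1}}+p_{s+1}, …),
-- evaluated at 0-based position t (i.e. its (t+1)-st entry).

stairSeq : List Step → List ℕ → ℕ → ℕ
stairSeq []                     μ t = 0
stairSeq ((p , ix a , ix b) ∷ S) μ t =
  if t <ᵇ (suc b ∸ a) then at μ (a + t) + p else stairSeq S μ (t ∸ (suc b ∸ a))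
stairSeq ((p , ix a , ∞) ∷ S)    μ t = at μ (a + t) + p
stairSeq ((p , ∞ , _) ∷ S)       μ t = p

-- Σ_{j=a}^{b} (μ_j + p).  For an infinite block [a,∞] (which in a staircase
-- only occurs with p = 0) this is Σ_{j ≥ a} μ_j, a finite sum.
blockSum : Step → List ℕ → ℕ
blockSum (p , ix a , ix b) μ = sum (map (λ t → at μ (a + t) + p) (upTo (suc b ∸ a)))
blockSum (p , ix a , ∞)    μ = sum (drop a μ)
blockSum (p , ∞ , _)       μ = p

stairWeight : List Step → List ℕ → ℕ
stairWeight S μ = sum (map (λ st → blockSum st μ) S)

module Submission where

-- Both ∨_P(μ) and stairList μ S are weakly decreasing lists of positive
-- integers, and such a list is determined by its multiplicities.  Since ∨
-- takes maxima of multiplicities, it suffices to show, for every m > 0: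
--   (upper) mult m (μ + α) ≤ mult m (stairList μ S) for every α ∈ P, and
--   (lower) mult m (stairList μ S) ≤ mult m (μ + σ) for some σ ∈ P.
-- Multiplicities are compared position by position, as finite sums
-- Σ_{t<N} [m = L_t].  Upper bound: every position t of α lies in a step
-- (p,[a,b]) of S with α_t = p, because a largest p-interval through t is a
-- member of the profile.  Lower bound: let (p,[a,b]) be the first step whose
-- block contains a value ≤ m; all values m of stairList μ S lie in this block,
-- and a σ ∈ P that equals p on [a,b] reproduces the block inside μ + σ.

open import Defs
open import Data.Nat
  using (ℕ; zero; suc; _+_; _∸_; _≤_; _<_; _⊔_; _<ᵇ_; _≟_; z≤n; s≤s; z<s; s<s; _≤?_; _<?_)
open import Data.Nat.Properties
open import Data.Nat.ListAction using (sum)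
open import Data.Nat.ListAction.Properties using (sum-++)
open import Data.List using (List; []; _∷_; map; length; filter; replicate; _++_; drop; applyUpTo)
import Data.List.Properties as List
open import Data.List.Relation.Unary.All as All using (All; []; _∷_)
import Data.List.Relation.Unary.All.Properties as AllP
open import Data.List.Relation.Unary.Linked using (_∷_)
open import Data.List.Relation.Unary.Any using (here; there)
open import Data.List.Membership.Propositional using (_∈_)
open import Data.List.Membership.Propositional.Properties using (∈-filter⁺; ∈-filter⁻; ∈-map⁺)
open import Data.List.Extrema.Nat using (argmax; argmax-all; f[xs]≤f[argmax])
open import Data.Product using (Σ; ∃; _×_; _,_; proj₁; proj₂)
open import Data.Sum using (_⊎_; inj₁; inj₂)
open import Data.Empty using (⊥-elim)
open import Data.Unit using (⊤; tt)
open import Data.Bool using (true; false; T)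
open import Relation.Nullary using (Dec; yes; no; ¬_)
open import Relation.Nullary.Decidable using (_×-dec_)
open import Relation.Binary.Definitions using (tri<; tri≈; tri>)
open import Relation.Binary.PropositionalEquality
open import Algebra.Properties.CommutativeSemigroup +-commutativeSemigroup using (interchange)

sumBelow : (ℕ → ℕ) → ℕ → ℕ
sumBelow f zero    = 0
sumBelow f (suc n) = f 0 + sumBelow (λ t → f (suc t)) n

sumBelow-cong : ∀ {f g : ℕ → ℕ} n → (∀ t → t < n → f t ≡ g t) → sumBelow f n ≡ sumBelow g n
sumBelow-cong zero    _ = refl
sumBelow-cong (suc n) h = cong₂ _+_ (h 0 z<s) (sumBelow-cong n (λ t t<n → h (suc t) (s<s t<n)))

sumBelow-zero : ∀ {f : ℕ → ℕ} n → (∀ t → t < n → f t ≡ 0) → sumBelow f n ≡ 0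
sumBelow-zero zero    _ = refl
sumBelow-zero (suc n) h = cong₂ _+_ (h 0 z<s) (sumBelow-zero n (λ t t<n → h (suc t) (s<s t<n)))

sumBelow-mono : ∀ {f g : ℕ → ℕ} n → (∀ t → f t ≤ g t) → sumBelow f n ≤ sumBelow g n
sumBelow-mono zero    _ = z≤n
sumBelow-mono (suc n) h = +-mono-≤ (h 0) (sumBelow-mono n (λ t → h (suc t)))

sumBelow-+ : ∀ (f g : ℕ → ℕ) n → sumBelow (λ t → f t + g t) n ≡ sumBelow f n + sumBelow g n
sumBelow-+ f g zero    = refl
sumBelow-+ f g (suc n) =
  trans (cong (f 0 + g 0 +_) (sumBelow-+ (λ t → f (suc t)) (λ t → g (suc t)) n))
        (interchange (f 0) (g 0) _ _)

sumBelow-split : ∀ (f : ℕ → ℕ) a n → sumBelow f (a + n) ≡ sumBelow f a + sumBelow (λ t → f (a + t)) n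
sumBelow-split f zero    n = refl
sumBelow-split f (suc a) n =
  trans (cong (f 0 +_) (sumBelow-split (λ t → f (suc t)) a n)) (sym (+-assoc (f 0) _ _))

sumBelow-window : ∀ (f : ℕ → ℕ) a k N → a + k ≤ N →
                  (∀ t → t < a → f t ≡ 0) → (∀ t → a + k ≤ t → t < N → f t ≡ 0) →
                  sumBelow f N ≡ sumBelow (λ t → f (a + t)) k
sumBelow-window f a k N a+k≤N below above = begin
  sumBelow f N                                                     ≡⟨ cong (sumBelow f) (sym N≡) ⟩
  sumBelow f (a + (k + e))                                         ≡⟨ sumBelow-split f a (k + e) ⟩
  sumBelow f a + sumBelow (λ t → f (a + t)) (k + e)                ≡⟨ cong₂ _+_ (sumBelow-zero a below)
                                                                        (sumBelow-split (λ t → f (a + t)) k e) ⟩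
  sumBelow (λ t → f (a + t)) k + sumBelow (λ t → f (a + (k + t))) e ≡⟨ cong (sumBelow (λ t → f (a + t)) k +_)
                                                                        (sumBelow-zero e beyond) ⟩
  sumBelow (λ t → f (a + t)) k + 0                                 ≡⟨ +-identityʳ _ ⟩
  sumBelow (λ t → f (a + t)) k                                     ∎
  where
  open ≡-Reasoning
  e : ℕ
  e = N ∸ (a + k)
  N≡ : a + (k + e) ≡ N
  N≡ = trans (sym (+-assoc a k e)) (m+[n∸m]≡n a+k≤N)
  beyond : ∀ t → t < e → f (a + (k + t)) ≡ 0
  beyond t t<e = above _ (+-monoʳ-≤ a (m≤m+n k t))
                         (subst (a + (k + t) <_) N≡ (+-monoʳ-< a (+-monoʳ-< k t<e)))

+-tight : ∀ {a b c d} → a ≤ b → c ≤ d → b + d ≤ a + c → a ≡ b × c ≡ d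
+-tight a≤b c≤d b+d≤a+c with m≤n⇒m<n∨m≡n a≤b | m≤n⇒m<n∨m≡n c≤d
... | inj₂ a≡b | inj₂ c≡d = a≡b , c≡d
... | inj₁ a<b | _        = ⊥-elim (<⇒≱ (+-mono-<-≤ a<b c≤d) b+d≤a+c)
... | inj₂ a≡b | inj₁ c<d = ⊥-elim (<⇒≱ (+-mono-≤-< a≤b c<d) b+d≤a+c)

sumBelow-tight : ∀ {f g : ℕ → ℕ} n → (∀ t → f t ≤ g t) → sumBelow g n ≤ sumBelow f n →
                 ∀ t → t < n → f t ≡ g t
sumBelow-tight (suc n) f≤g g≤f t t<n with +-tight (f≤g 0) (sumBelow-mono n (λ t → f≤g (suc t))) g≤f
sumBelow-tight (suc n) f≤g g≤f zero    _         | f0≡g0 , _ = f0≡g0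
sumBelow-tight (suc n) f≤g g≤f (suc t) (s≤s t<n) | _ , rest≡ =
  sumBelow-tight n (λ t → f≤g (suc t)) (≤-reflexive (sym rest≡)) t t<n

δ : ℕ → ℕ → ℕ
δ m x with m ≟ x
... | yes _ = 1
... | no  _ = 0

δ-yes : ∀ {m x} → m ≡ x → δ m x ≡ 1
δ-yes {m} {x} m≡x with m ≟ x
... | yes _   = refl
... | no  m≢x = ⊥-elim (m≢x m≡x)

δ-no : ∀ {m x} → m ≢ x → δ m x ≡ 0
δ-no {m} {x} m≢x with m ≟ x
... | yes m≡x = ⊥-elim (m≢x m≡x)
... | no  _   = refl

δ-one : ∀ {m x} → δ m x ≡ 1 → m ≡ x
δ-one {m} {x} δ≡1 with m ≟ x
... | yes m≡x = m≡x
... | no  _   = ⊥-elim (0≢1+n δ≡1)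

δ-mono : ∀ {m x y} → (x ≡ m → y ≡ m) → δ m x ≤ δ m y
δ-mono {m} {x} {y} x⇒y with m ≟ x
... | yes m≡x = ≤-reflexive (sym (δ-yes (sym (x⇒y (sym m≡x)))))
... | no  _   = z≤n

mult-∷ : ∀ m x xs → mult m (x ∷ xs) ≡ δ m x + mult m xs
mult-∷ m x xs with m ≟ x
... | yes m≡x = cong length (List.filter-accept (m ≟_) m≡x)
... | no  m≢x = cong length (List.filter-reject (m ≟_) m≢x)

mult-++ : ∀ m xs ys → mult m (xs ++ ys) ≡ mult m xs + mult m ys
mult-++ m xs ys = trans (cong length (List.filter-++ (m ≟_) xs ys)) (List.length-++ (filter (m ≟_) xs))

mult-absent : ∀ {m} xs → All (m ≢_) xs → mult m xs ≡ 0
mult-absent {m} xs m∉xs = cong length (List.filter-none (m ≟_) m∉xs)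

mult-replicate : ∀ m k → mult m (replicate k m) ≡ k
mult-replicate m zero    = refl
mult-replicate m (suc k) = trans (mult-∷ m m _) (cong₂ _+_ (δ-yes refl) (mult-replicate m k))

mult-applyUpTo : ∀ m (g : ℕ → ℕ) k → mult m (applyUpTo g k) ≡ sumBelow (λ t → δ m (g t)) k
mult-applyUpTo m g zero    = refl
mult-applyUpTo m g (suc k) = trans (mult-∷ m (g 0) _) (cong (δ m (g 0) +_) (mult-applyUpTo m (λ t → g (suc t)) k))

at-beyond : ∀ (xs : List ℕ) {t} → length xs ≤ t → at xs t ≡ 0
at-beyond []       _         = refl
at-beyond (x ∷ xs) (s≤s len) = at-beyond xs len

at-applyUpTo : ∀ (g : ℕ → ℕ) {k} t → t < k → at (applyUpTo g k) t ≡ g t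
at-applyUpTo g {suc k} zero    _         = refl
at-applyUpTo g {suc k} (suc t) (s≤s t<k) = at-applyUpTo (λ t → g (suc t)) t t<k

at-drop : ∀ (xs : List ℕ) a t → at (drop a xs) t ≡ at xs (a + t)
at-drop xs       zero    t = refl
at-drop []       (suc a) t = refl
at-drop (x ∷ xs) (suc a) t = at-drop xs a t

at-++ˡ : ∀ (xs ys : List ℕ) {t} → t < length xs → at (xs ++ ys) t ≡ at xs t
at-++ˡ (x ∷ xs) ys {zero}  _         = refl
at-++ˡ (x ∷ xs) ys {suc t} (s≤s t<n) = at-++ˡ xs ys t<n

at-++ʳ : ∀ (xs ys : List ℕ) {t} → length xs ≤ t → at (xs ++ ys) t ≡ at ys (t ∸ length xs)
at-++ʳ []       ys _         = refl
at-++ʳ (x ∷ xs) ys (s≤s n≤t) = at-++ʳ xs ys n≤t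

at-⊕ : ∀ μ α t → at (μ ⊕ α) t ≡ at μ t + at α t
at-⊕ []       α       t       = refl
at-⊕ (x ∷ μ) []       t       = sym (+-identityʳ _)
at-⊕ (x ∷ μ) (y ∷ α) zero    = refl
at-⊕ (x ∷ μ) (y ∷ α) (suc t) = at-⊕ μ α t

length-⊕ : ∀ μ α {N} → length μ ≤ N → length α ≤ N → length (μ ⊕ α) ≤ N
length-⊕ []       α       _         α≤N       = α≤N
length-⊕ (x ∷ μ) []       μ≤N       _         = μ≤N
length-⊕ (x ∷ μ) (y ∷ α) (s≤s μ≤N) (s≤s α≤N) = s≤s (length-⊕ μ α μ≤N α≤N)

mult-positional : ∀ {m} → m ≢ 0 → ∀ xs {N} → length xs ≤ N →
                  mult m xs ≡ sumBelow (λ t → δ m (at xs t)) N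
mult-positional m≢0 []       {N}     _         = sym (sumBelow-zero N (λ _ _ → δ-no m≢0))
mult-positional m≢0 (x ∷ xs) {suc N} (s≤s len) =
  trans (mult-∷ _ x xs) (cong (δ _ x +_) (mult-positional m≢0 xs len))

mult-⊕ : ∀ {m} → m ≢ 0 → ∀ μ α {N} → length μ ≤ N → length α ≤ N →
         mult m (μ ⊕ α) ≡ sumBelow (λ t → δ m (at μ t + at α t)) N
mult-⊕ m≢0 μ α {N} μ≤N α≤N =
  trans (mult-positional m≢0 (μ ⊕ α) (length-⊕ μ α μ≤N α≤N))
        (sumBelow-cong N (λ t _ → cong (δ _) (at-⊕ μ α t)))

∈⇒≤sum : ∀ {n ns} → n ∈ ns → n ≤ sum ns
∈⇒≤sum (here refl) = m≤m+n _ _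
∈⇒≤sum {ns = n′ ∷ ns} (there n∈ns) = ≤-trans (∈⇒≤sum n∈ns) (m≤n+m _ n′)

Dsc : ℕ → List ℕ → Set
Dsc v []       = ⊤
Dsc v (x ∷ xs) = x ≤ v × Dsc x xs

Dsc-weaken : ∀ {u v} xs → u ≤ v → Dsc u xs → Dsc v xs
Dsc-weaken []       _   _          = tt
Dsc-weaken (x ∷ xs) u≤v (x≤u , d) = ≤-trans x≤u u≤v , d

Dsc-bound : ∀ {v} xs → Dsc v xs → All (_≤ v) xs
Dsc-bound []       _          = []
Dsc-bound (x ∷ xs) (x≤v , d) = x≤v ∷ All.map (λ y≤x → ≤-trans y≤x x≤v) (Dsc-bound xs d)

Dsc-++ : ∀ {u v} xs ys → Dsc v xs → All (u ≤_) xs → Dsc u ys → u ≤ v → Dsc v (xs ++ ys)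
Dsc-++ []       ys _          _            dys u≤v = Dsc-weaken ys u≤v dys
Dsc-++ (x ∷ xs) ys (x≤v , d) (u≤x ∷ u≤xs) dys _   = x≤v , Dsc-++ xs ys d u≤xs dys u≤x

Dsc-antitone : ∀ {v} xs → Dsc v xs → ∀ {i j} → i ≤ j → at xs j ≤ at xs i
Dsc-antitone []       _          _                 = z≤n
Dsc-antitone (x ∷ xs) _          {zero}  {zero}  _ = ≤-refl
Dsc-antitone (x ∷ xs) (_ , d)    {zero}  {suc j} _ = head-bound xs d
  where
  head-bound : ∀ {v} ys → Dsc v ys → ∀ {j} → at ys j ≤ v
  head-bound []       _          = z≤n
  head-bound (y ∷ ys) (y≤v , d) {zero}  = y≤v
  head-bound (y ∷ ys) (y≤v , d) {suc j} = ≤-trans (head-bound ys d) y≤v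
Dsc-antitone (x ∷ xs) (_ , d) {suc i} {suc j} (s≤s i≤j) = Dsc-antitone xs d i≤j

Dsc-drop : ∀ {v} xs a → Dsc v xs → Dsc (at xs a) (drop a xs)
Dsc-drop []       zero    _       = tt
Dsc-drop []       (suc a) _       = tt
Dsc-drop (x ∷ xs) zero    (_ , d) = ≤-refl , d
Dsc-drop (x ∷ xs) (suc a) (_ , d) = Dsc-drop xs a d

Dsc-applyUpTo : ∀ {v} (g : ℕ → ℕ) k → (∀ t → g (suc t) ≤ g t) → g 0 ≤ v → Dsc v (applyUpTo g k)
Dsc-applyUpTo g zero    _    _     = tt
Dsc-applyUpTo g (suc k) g↓ g0≤v = g0≤v , Dsc-applyUpTo (λ t → g (suc t)) k (λ t → g↓ (suc t)) (g↓ 0)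

partition-Dsc : ∀ {μ} → IsPartition μ → Dsc (at μ 0) μ
partition-Dsc {[]}        _             = tt
partition-Dsc {x ∷ []}    _             = ≤-refl , tt
partition-Dsc {x ∷ y ∷ μ} (y≤x ∷ l , _ ∷ pos) = ≤-refl , Dsc-weaken (y ∷ μ) y≤x (partition-Dsc (l , pos))

mult-above : ∀ {v m} xs → Dsc v xs → v < m → mult m xs ≡ 0
mult-above xs d v<m =
  mult-absent xs (All.map (λ x≤v m≡x → <⇒≱ v<m (subst (_≤ _) (sym m≡x) x≤v)) (Dsc-bound xs d))

mult-head : ∀ x xs → mult x (x ∷ xs) ≢ 0
mult-head x xs e = 1+n≢0 (trans (cong (_+ mult x xs) (sym (δ-yes refl))) (trans (sym (mult-∷ x x xs)) e))

Dsc-unique : ∀ {v w} xs ys → Dsc v xs → Dsc w ys → All (0 <_) xs → All (0 <_) ys →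
             (∀ m → m ≢ 0 → mult m xs ≡ mult m ys) → xs ≡ ys
Dsc-unique []       []       _         _         _            _            _ = refl
Dsc-unique []       (y ∷ ys) _         _         _            (0<y ∷ _)    same =
  ⊥-elim (mult-head y ys (sym (same y (λ y≡0 → <⇒≢ 0<y (sym y≡0)))))
Dsc-unique (x ∷ xs) []       _         _         (0<x ∷ _)    _            same =
  ⊥-elim (mult-head x xs (same x (λ x≡0 → <⇒≢ 0<x (sym x≡0))))
Dsc-unique (x ∷ xs) (y ∷ ys) (_ , dxs) (_ , dys) (0<x ∷ pxs) (0<y ∷ pys) same with <-cmp x y
... | tri< x<y _ _ =
  ⊥-elim (mult-head y ys (trans (sym (same y (λ y≡0 → <⇒≢ 0<y (sym y≡0))))
                                (mult-above (x ∷ xs) (≤-refl , dxs) x<y)))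
... | tri> _ _ y<x =
  ⊥-elim (mult-head x xs (trans (same x (λ x≡0 → <⇒≢ 0<x (sym x≡0)))
                                (mult-above (y ∷ ys) (≤-refl , dys) y<x)))
... | tri≈ _ refl _ =
  cong (x ∷_) (Dsc-unique xs ys dxs dys pxs pys (λ m m≢0 →
    +-cancelˡ-≡ (δ m x) _ _ (trans (sym (mult-∷ m x xs)) (trans (same m m≢0) (mult-∷ m x ys)))))

fromMult-Dsc : ∀ n f → Dsc n (fromMult n f)
fromMult-Dsc zero    f = tt
fromMult-Dsc (suc n) f =
  Dsc-++ (replicate k (suc n)) (fromMult n f) (top k) (AllP.replicate⁺ k (n≤1+n n)) (fromMult-Dsc n f) (n≤1+n n)
  where
  k : ℕ
  k = f (suc n)
  top : ∀ k → Dsc (suc n) (replicate k (suc n))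
  top zero    = tt
  top (suc k) = ≤-refl , top k

fromMult-pos : ∀ n f → All (0 <_) (fromMult n f)
fromMult-pos zero    f = []
fromMult-pos (suc n) f = AllP.++⁺ (AllP.replicate⁺ (f (suc n)) z<s) (fromMult-pos n f)

mult-fromMult : ∀ {m} n f → m ≢ 0 → m ≤ n → mult m (fromMult n f) ≡ f m
mult-fromMult {m} zero    f m≢0 z≤n = ⊥-elim (m≢0 refl)
mult-fromMult {m} (suc n) f m≢0 m≤1+n with m ≟ suc n
... | yes refl = begin
  mult m (replicate (f m) m ++ fromMult n f)          ≡⟨ mult-++ m (replicate (f m) m) _ ⟩
  mult m (replicate (f m) m) + mult m (fromMult n f) ≡⟨ cong₂ _+_ (mult-replicate m (f m))
                                                          (mult-above (fromMult n f) (fromMult-Dsc n f) ≤-refl) ⟩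
  f m + 0                                             ≡⟨ +-identityʳ _ ⟩
  f m                                                 ∎
  where open ≡-Reasoning
... | no m≢1+n = begin
  mult m (replicate (f (suc n)) (suc n) ++ fromMult n f)          ≡⟨ mult-++ m (replicate (f (suc n)) (suc n)) _ ⟩
  mult m (replicate (f (suc n)) (suc n)) + mult m (fromMult n f) ≡⟨ cong (_+ mult m (fromMult n f))
                                                                      (mult-absent _ (AllP.replicate⁺ (f (suc n)) m≢1+n)) ⟩
  mult m (fromMult n f)                                           ≡⟨ mult-fromMult n f m≢0 (≤-pred (≤∧≢⇒< m≤1+n m≢1+n)) ⟩
  f m                                                             ∎
  where open ≡-Reasoning

maxPart-bound : ∀ xs → All (_≤ maxPart xs) xs
maxPart-bound []       = []
maxPart-bound (x ∷ xs) = m≤m⊔n x _ ∷ All.map (λ y≤ → ≤-trans y≤ (m≤n⊔m x _)) (maxPart-bound xs)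

mult-above-max : ∀ {m} xs → maxPart xs < m → mult m xs ≡ 0
mult-above-max xs max<m =
  mult-absent xs (All.map (λ x≤max m≡x → <⇒≱ max<m (subst (_≤ _) (sym m≡x) x≤max)) (maxPart-bound xs))

∨-Dsc : ∀ α β → Dsc (maxPart α ⊔ maxPart β) (α ∨ β)
∨-Dsc α β = fromMult-Dsc (maxPart α ⊔ maxPart β) (λ m → mult m α ⊔ mult m β)

∨-pos : ∀ α β → All (0 <_) (α ∨ β)
∨-pos α β = fromMult-pos (maxPart α ⊔ maxPart β) (λ m → mult m α ⊔ mult m β)

mult-∨ : ∀ {m} α β → m ≢ 0 → mult m (α ∨ β) ≡ mult m α ⊔ mult m β
mult-∨ {m} α β m≢0 with m ≤? maxPart α ⊔ maxPart β
... | yes m≤max = mult-fromMult _ _ m≢0 m≤max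
... | no  m≰max = begin
  mult m (α ∨ β)          ≡⟨ mult-above (α ∨ β) (∨-Dsc α β) max<m ⟩
  0                       ≡⟨ sym (cong₂ _⊔_ (mult-above-max α (≤-<-trans (m≤m⊔n _ _) max<m))
                                           (mult-above-max β (≤-<-trans (m≤n⊔m _ _) max<m))) ⟩
  mult m α ⊔ mult m β     ∎
  where
  open ≡-Reasoning
  max<m = ≰⇒> m≰max

veeP-Dsc : ∀ P μ → ∃ λ v → Dsc v (veeP P μ)
veeP-Dsc []      μ = 0 , tt
veeP-Dsc (α ∷ P) μ = _ , ∨-Dsc (μ ⊕ α) (veeP P μ)

veeP-pos : ∀ P μ → All (0 <_) (veeP P μ)
veeP-pos []      μ = []
veeP-pos (α ∷ P) μ = ∨-pos (μ ⊕ α) (veeP P μ)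

veeP-upper : ∀ {m} P μ {α} → m ≢ 0 → α ∈ P → mult m (μ ⊕ α) ≤ mult m (veeP P μ)
veeP-upper {m} (β ∷ P) μ m≢0 (here refl) =
  ≤-trans (m≤m⊔n _ _) (≤-reflexive (sym (mult-∨ (μ ⊕ β) (veeP P μ) m≢0)))
veeP-upper {m} (β ∷ P) μ m≢0 (there α∈P) =
  ≤-trans (veeP-upper P μ m≢0 α∈P)
          (≤-trans (m≤n⊔m _ _) (≤-reflexive (sym (mult-∨ (μ ⊕ β) (veeP P μ) m≢0))))

veeP-least : ∀ {m k} P μ → m ≢ 0 → (∀ α → α ∈ P → mult m (μ ⊕ α) ≤ k) → mult m (veeP P μ) ≤ k
veeP-least []      μ m≢0 bound = z≤n
veeP-least (β ∷ P) μ m≢0 bound =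
  ≤-trans (≤-reflexive (mult-∨ (μ ⊕ β) (veeP P μ) m≢0))
          (⊔-lub (bound β (here refl)) (veeP-least P μ m≢0 (λ α α∈P → bound α (there α∈P))))

-- Staircases in normal form, with 0-based block positions: Stairs lo hi S
-- says that S is (p₁,[a₁,b₁]), …, (p_s,[a_s,b_s]), (0,[a_{s+1},∞]) with
-- lo ≤ a₁ ≤ b₁ ≤ a₂ ≤ b₂ ≤ ⋯ and hi > p₁ > ⋯ > p_s > 0.
data Stairs (lo hi : ℕ) : List Step → Set where
  final : ∀ {a} → lo ≤ a → 0 < hi → Stairs lo hi ((0 , ix a , ∞) ∷ [])
  step  : ∀ {p a b S} → lo ≤ a → a ≤ b → 0 < p → p < hi → Stairs b p S →
          Stairs lo hi ((p , ix a , ix b) ∷ S)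

-- A position beyond all finite blocks and the start of the infinite one.
reach : List Step → ℕ
reach []                      = 0
reach ((_ , ix a , ix b) ∷ S) = suc b + reach S
reach ((_ , ix a , ∞) ∷ _)    = a
reach ((_ , ∞ , _) ∷ _)       = 0

_≤I?_ : ∀ i j → Dec (i ≤I j)
ix m ≤I? ix n with m ≤? n
... | yes m≤n = yes (ix≤ix m≤n)
... | no  m≰n = no λ { (ix≤ix m≤n) → m≰n m≤n }
i    ≤I? ∞    = yes (i ≤∞)
∞    ≤I? ix n = no λ ()

inInterval? : ∀ a b i → Dec (Interval a b i)
inInterval? a b i = (a ≤I? i) ×-dec (i ≤I? b)

block-index : ∀ {a b t} → a ≤ b → t < suc b ∸ a → a + t ≤ b
block-index {a} {b} {t} a≤b t<k = ≤-pred (subst (a + t <_) (m+[n∸m]≡n (m≤n⇒m≤1+n a≤b)) (+-monoʳ-< a t<k))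

module StairList (μ : List ℕ) where

  block : ℕ → ℕ → ℕ → List ℕ
  block p a b = applyUpTo (λ t → at μ (a + t) + p) (suc b ∸ a)

  stairList : List Step → List ℕ
  stairList []                      = []
  stairList ((p , ix a , ix b) ∷ S) = block p a b ++ stairList S
  stairList ((p , ix a , ∞) ∷ S)    = drop a μ
  stairList ((p , ∞ , _) ∷ S)       = []

  stairSeq-stairList : ∀ {lo hi S} → Stairs lo hi S → ∀ t → stairSeq S μ t ≡ at (stairList S) t
  stairSeq-stairList (final {a} _ _) t = trans (+-identityʳ _) (sym (at-drop μ a t))
  stairSeq-stairList {S = (p , ix a , ix b) ∷ S} (step _ _ _ _ rest) t with t <ᵇ (suc b ∸ a) in lt?
  ... | true  = sym (trans (at-++ˡ (block p a b) (stairList S) (subst (t <_) (sym len) t<k))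
                           (at-applyUpTo (λ t → at μ (a + t) + p) t t<k))
    where t<k = <ᵇ⇒< t (suc b ∸ a) (subst T (sym lt?) tt)
          len = List.length-applyUpTo (λ t → at μ (a + t) + p) (suc b ∸ a)
  ... | false = begin
    stairSeq S μ (t ∸ (suc b ∸ a))               ≡⟨ stairSeq-stairList rest (t ∸ (suc b ∸ a)) ⟩
    at (stairList S) (t ∸ (suc b ∸ a))           ≡⟨ cong (λ k → at (stairList S) (t ∸ k)) (sym len) ⟩
    at (stairList S) (t ∸ length (block p a b))  ≡⟨ sym (at-++ʳ (block p a b) (stairList S) k≤t) ⟩
    at (block p a b ++ stairList S) t            ∎
    where
    open ≡-Reasoning
    len = List.length-applyUpTo (λ t → at μ (a + t) + p) (suc b ∸ a)
    k≤t = subst (_≤ t) (sym len) (≮⇒≥ (λ t<k → subst T lt? (<⇒<ᵇ t<k)))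

  stairWeight-stairList : ∀ {lo hi S} → Stairs lo hi S → sum (stairList S) ≡ stairWeight S μ
  stairWeight-stairList (final _ _) = sym (+-identityʳ _)
  stairWeight-stairList {S = (p , ix a , ix b) ∷ S} (step _ _ _ _ rest) =
    trans (sum-++ (block p a b) (stairList S))
          (cong₂ _+_ (cong sum (sym (List.map-applyUpTo (λ t → t) (λ t → at μ (a + t) + p) (suc b ∸ a))))
                     (stairWeight-stairList rest))

  stairList-pos : ∀ {lo hi S} → Stairs lo hi S → All (0 <_) μ → All (0 <_) (stairList S)
  stairList-pos (final {a} _ _)           μ-pos = AllP.drop⁺ a μ-pos
  stairList-pos (step {p} _ _ 0<p _ rest) μ-pos =
    AllP.++⁺ (AllP.applyUpTo⁺₂ _ _ (λ t → ≤-trans 0<p (m≤n+m p _))) (stairList-pos rest μ-pos)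

  -- For decreasing μ the blocks decrease and each block lies strictly above
  -- the following ones; hence stairList is decreasing.
  module _ {v} (μ-Dsc : Dsc v μ) where

    μ-antitone : ∀ {i j} → i ≤ j → at μ j ≤ at μ i
    μ-antitone = Dsc-antitone μ μ-Dsc

    stairList-below : ∀ {lo hi S} → Stairs lo hi S → All (_< at μ lo + hi) (stairList S)
    stairList-below (final {a} lo≤a 0<hi) =
      All.map (λ x≤μa → ≤-<-trans x≤μa (≤-<-trans (μ-antitone lo≤a) (m<m+n _ 0<hi)))
              (Dsc-bound (drop a μ) (Dsc-drop μ a μ-Dsc))
    stairList-below (step {p} {a} {b} lo≤a a≤b _ p<hi rest) =
      AllP.++⁺ (AllP.applyUpTo⁺₂ _ _ (λ t → +-mono-≤-< (μ-antitone (≤-trans lo≤a (m≤m+n a t))) p<hi))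
               (All.map (λ x< → <-≤-trans x< (+-mono-≤ (μ-antitone (≤-trans lo≤a a≤b)) (<⇒≤ p<hi)))
                        (stairList-below rest))

    stairList-Dsc : ∀ {lo hi S} → Stairs lo hi S → Dsc (at μ lo + hi) (stairList S)
    stairList-Dsc (final {a} lo≤a _) =
      Dsc-weaken (drop a μ) (≤-trans (μ-antitone lo≤a) (m≤m+n _ _)) (Dsc-drop μ a μ-Dsc)
    stairList-Dsc (step {p} {a} {b} lo≤a a≤b _ p<hi rest) =
      Dsc-++ (block p a b) _
        (Dsc-applyUpTo _ (suc b ∸ a) (λ t → +-monoˡ-≤ p (μ-antitone (+-monoʳ-≤ a (n≤1+n t))))
                       (+-mono-≤ (μ-antitone (≤-trans lo≤a (m≤m+n a 0))) (<⇒≤ p<hi)))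
        (AllP.applyUpTo⁺₁ _ _ (λ t<k → +-monoˡ-≤ p (μ-antitone (block-index a≤b t<k))))
        (stairList-Dsc rest)
        (+-mono-≤ (μ-antitone (≤-trans lo≤a a≤b)) (<⇒≤ p<hi))

    mult-block-below : ∀ {p a b m} → a ≤ b → m < at μ b + p → mult m (block p a b) ≡ 0
    mult-block-below {p} {a} {b} a≤b m<min = mult-absent (block p a b) (AllP.applyUpTo⁺₁ _ _ (λ t<k m≡x →
      <⇒≢ (<-≤-trans m<min (+-monoˡ-≤ p (μ-antitone (block-index a≤b t<k)))) m≡x))

    mult-stairList-above : ∀ {p b S m} → Stairs b p S → at μ b + p ≤ m → mult m (stairList S) ≡ 0
    mult-stairList-above {S = S} stairs min≤m = mult-absent (stairList S)
      (All.map (λ x<min m≡x → <⇒≱ (subst (_< _) (sym m≡x) x<min) min≤m) (stairList-below stairs))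

  stepCount : Step → ℕ → ℕ → ℕ
  stepCount (p , a , b) m t with inInterval? a b (ix t)
  ... | yes _ = δ m (at μ t + p)
  ... | no  _ = 0

  stepCount-in : ∀ p a b m t → Interval a b (ix t) → stepCount (p , a , b) m t ≡ δ m (at μ t + p)
  stepCount-in p a b m t t∈ab with inInterval? a b (ix t)
  ... | yes _   = refl
  ... | no  t∉ab = ⊥-elim (t∉ab t∈ab)

  stepCount-out : ∀ p a b m t → ¬ Interval a b (ix t) → stepCount (p , a , b) m t ≡ 0
  stepCount-out p a b m t t∉ab with inInterval? a b (ix t)
  ... | yes t∈ab = ⊥-elim (t∉ab t∈ab)
  ... | no  _    = refl

  stepCount-realised : ∀ {p a b} σ → (∀ i → Interval a b i → val σ i ≡ p) →
                       ∀ m t → stepCount (p , a , b) m t ≤ δ m (at μ t + at σ t)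
  stepCount-realised {p} {a} {b} σ σ≡p m t with inInterval? a b (ix t)
  ... | yes t∈ab = ≤-reflexive (cong (λ q → δ m (at μ t + q)) (sym (σ≡p (ix t) t∈ab)))
  ... | no  _    = z≤n

  stairCount : List Step → ℕ → ℕ → ℕ
  stairCount S m t = sum (map (λ s → stepCount s m t) S)

  stepCount-window : ∀ {p a b} m k N → a + k ≤ N →
                     (∀ t → t < k → ix (a + t) ≤I b) → (∀ t → a + k ≤ t → t < N → ¬ (ix t ≤I b)) →
                     sumBelow (stepCount (p , ix a , b) m) N ≡ sumBelow (λ t → δ m (at μ (a + t) + p)) k
  stepCount-window {p} {a} {b} m k N a+k≤N inside outside =
    trans (sumBelow-window (stepCount (p , ix a , b) m) a k N a+k≤N
                           (λ t t<a → stepCount-out p (ix a) b m t (λ { (ix≤ix a≤t , _) → <⇒≱ t<a a≤t }))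
                           (λ t a+k≤t t<N → stepCount-out p (ix a) b m t (λ (_ , t≤b) → outside t a+k≤t t<N t≤b)))
          (sumBelow-cong k (λ t t<k → stepCount-in p (ix a) b m (a + t) (ix≤ix (m≤m+n a t) , inside t t<k)))

  mult-block : ∀ {p a b N} m → a ≤ b → suc b ≤ N →
               mult m (block p a b) ≡ sumBelow (stepCount (p , ix a , ix b) m) N
  mult-block {p} {a} {b} {N} m a≤b b<N =
    trans (mult-applyUpTo m _ k)
          (sym (stepCount-window m k N (subst (_≤ N) (sym a+k≡) b<N)
                                 (λ t t<k → ix≤ix (block-index a≤b t<k))
                                 (λ t a+k≤t _ → λ { (ix≤ix t≤b) → <⇒≱ (subst (_≤ t) a+k≡ a+k≤t) t≤b })))
    where
    k : ℕ
    k = suc b ∸ a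
    a+k≡ : a + k ≡ suc b
    a+k≡ = m+[n∸m]≡n (m≤n⇒m≤1+n a≤b)

  mult-tail : ∀ {a N m} → m ≢ 0 → a ≤ N → length μ ≤ N →
              mult m (drop a μ) ≡ sumBelow (stepCount (0 , ix a , ∞) m) N
  mult-tail {a} {N} {m} m≢0 a≤N μ≤N = begin
    mult m (drop a μ)                           ≡⟨ mult-positional m≢0 (drop a μ) len ⟩
    sumBelow (λ t → δ m (at (drop a μ) t)) k    ≡⟨ sumBelow-cong k (λ t _ → cong (δ m) (at-drop+0 t)) ⟩
    sumBelow (λ t → δ m (at μ (a + t) + 0)) k   ≡⟨ sym (stepCount-window m k N (≤-reflexive a+k≡) (λ _ _ → _ ≤∞)
                                                      (λ t a+k≤t t<N _ → <⇒≱ t<N (subst (_≤ t) a+k≡ a+k≤t))) ⟩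
    sumBelow (stepCount (0 , ix a , ∞) m) N     ∎
    where
    open ≡-Reasoning
    k : ℕ
    k = N ∸ a
    a+k≡ : a + k ≡ N
    a+k≡ = m+[n∸m]≡n a≤N
    len : length (drop a μ) ≤ k
    len = subst (_≤ k) (sym (List.length-drop a μ)) (∸-monoˡ-≤ a μ≤N)
    at-drop+0 : ∀ t → at (drop a μ) t ≡ at μ (a + t) + 0
    at-drop+0 t = trans (at-drop μ a t) (sym (+-identityʳ _))

  mult-stairList : ∀ {lo hi S N m} → Stairs lo hi S → m ≢ 0 → reach S ≤ N → length μ ≤ N →
                   mult m (stairList S) ≡ sumBelow (λ t → stairCount S m t) N
  mult-stairList {N = N} (final _ _) m≢0 a≤N μ≤N =
    trans (mult-tail m≢0 a≤N μ≤N) (sumBelow-cong N (λ t _ → sym (+-identityʳ _)))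
  mult-stairList {S = (p , ix a , ix b) ∷ S} {N} {m} (step _ a≤b _ _ rest) m≢0 reach≤N μ≤N = begin
    mult m (block p a b ++ stairList S)                    ≡⟨ mult-++ m (block p a b) (stairList S) ⟩
    mult m (block p a b) + mult m (stairList S)            ≡⟨ cong₂ _+_ (mult-block m a≤b (≤-trans (m≤m+n _ _) reach≤N))
                                                               (mult-stairList rest m≢0 (≤-trans (m≤n+m _ _) reach≤N) μ≤N) ⟩
    sumBelow (stepCount (p , ix a , ix b) m) N + sumBelow (stairCount S m) N
                                                           ≡⟨ sym (sumBelow-+ _ _ N) ⟩
    sumBelow (stairCount ((p , ix a , ix b) ∷ S) m) N      ∎
    where open ≡-Reasoning

module Profile (P : List (List ℕ)) (S : List Step) (profile : ProfileIs P S) where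

  stepRealised : ∀ {p a b} → (p , a , b) ∈ S → ∃ λ σ → σ ∈ P × (∀ i → Interval a b i → val σ i ≡ p)
  stepRealised {p} {a} {b} s∈S
    with proj₂ (profile p (Interval a b)) ((p , a , b) , s∈S , refl , (λ _ i∈ → i∈) , (λ _ i∈ → i∈))
  ... | σ , σ∈P , (ab⊆σ , _) , _ = σ , σ∈P , ab⊆σ

  -- A step whose interval reaches ∞ has value σ_∞ = 0.
  infiniteStep : ∀ {p a} → (p , a , ∞) ∈ S → p ≡ 0
  infiniteStep {a = a} s∈S with stepRealised s∈S
  ... | _ , _ , σ≡p = sym (σ≡p ∞ (a ≤∞ , ∞ ≤∞))

  nextStart : ∀ {a′ b} → a′ ≡ ix b ⊎ a′ ≡ sucI (ix b) → ∃ λ a → a′ ≡ ix a × b ≤ a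
  nextStart (inj₁ refl) = _ , refl , ≤-refl
  nextStart (inj₂ refl) = _ , refl , n≤1+n _

  tailValue-pos : ∀ {p b} S′ → StairTail p (ix b) S′ → 0 < p
  tailValue-pos []      (_ , ())
  tailValue-pos (_ ∷ _) (p′<p , _) = ≤-trans z<s p′<p

  tail-Stairs : ∀ {p b} S′ → StairTail p (ix b) S′ → (∀ {s} → s ∈ S′ → s ∈ S) → Stairs b p S′
  tail-Stairs []                       (_ , ())                     _
  tail-Stairs ((p′ , a′ , b′) ∷ S′) (p′<p , a′≡ , _ , _) sub with nextStart a′≡
  tail-Stairs ((p′ , .(ix a) , ix b′) ∷ S′) (p′<p , _ , ix≤ix a≤b′ , tail) sub | a , refl , b≤a =
    step b≤a a≤b′ (tailValue-pos S′ tail) p′<p (tail-Stairs S′ tail (λ s∈ → sub (there s∈)))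
  tail-Stairs ((p′ , .(ix a) , ∞) ∷ S′) (p′<p , _ , _ , tail) sub | a , refl , b≤a
    with infiniteStep (sub (here refl))
  tail-Stairs ((.0 , .(ix a) , ∞) ∷ [])      (0<p , _ , _ , _)        _ | a , refl , b≤a | refl = final b≤a 0<p
  tail-Stairs ((.0 , .(ix a) , ∞) ∷ (_ ∷ _)) (_ , _ , _ , (q<0 , _)) _ | a , refl , b≤a | refl = ⊥-elim (n≮0 q<0)

  staircase-Stairs : IsStaircase S → ∃ λ hi → Stairs 0 hi S
  staircase-Stairs staircase = normalise S staircase (λ s∈ → s∈)
    where
    normalise : ∀ S′ → IsStaircase S′ → (∀ {s} → s ∈ S′ → s ∈ S) → ∃ λ hi → Stairs 0 hi S′
    normalise ((p , .(ix 0) , ix b) ∷ S′) (0<p , refl , _ , tail , _) sub =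
      suc p , step z≤n z≤n 0<p ≤-refl (tail-Stairs S′ tail (λ s∈ → sub (there s∈)))
    normalise ((p , .(ix 0) , ∞) ∷ S′) (0<p , refl , _ , _ , _) sub =
      ⊥-elim (<⇒≢ 0<p (sym (infiniteStep (sub (here refl)))))

  module Bounded (N : ℕ) (P≤N : ∀ τ → τ ∈ P → length τ ≤ N) where

    qCount : ℕ → List ℕ → ℕ
    qCount q τ = sumBelow (λ j → δ q (at τ j)) N

    Largest : ℕ → ℕ → List ℕ → Set
    Largest q t τ = ∀ τ′ → τ′ ∈ P → at τ′ t ≡ q → qCount q τ′ ≤ qCount q τ

    largest : ∀ {α} q t → α ∈ P → at α t ≡ q → ∃ λ τ → τ ∈ P × at τ t ≡ q × Largest q t τ
    largest {α} q t α∈P αt≡q = τ , proj₁ τ-ok , proj₂ τ-ok , bigger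
      where
      candidates : List (List ℕ)
      candidates = filter (λ τ → at τ t ≟ q) P
      τ : List ℕ
      τ = argmax (qCount q) α candidates
      τ-ok : τ ∈ P × at τ t ≡ q
      τ-ok = argmax-all (qCount q) (α∈P , αt≡q) (All.tabulate (∈-filter⁻ (λ τ → at τ t ≟ q)))
      bigger : Largest q t τ
      bigger τ′ τ′∈P τ′t≡q = All.lookup (f[xs]≤f[argmax] {f = qCount q} α candidates)
                                        (∈-filter⁺ (λ τ → at τ t ≟ q) τ′∈P τ′t≡q)

    -- A q-interval of largest size among those through t is inclusion-maximal,
    -- so it belongs to the profile.
    largest-inProfile : ∀ {τ q t} → τ ∈ P → at τ t ≡ q → Largest q t τ → InProfile P q (pInt τ q)
    largest-inProfile {τ} {q} {t} τ∈P τt≡q τ-largest =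
      τ , τ∈P , ((λ _ e → e) , (λ _ e → e)) , (ix t , τt≡q) , maximal
      where
      maximal : ∀ τ′ → τ′ ∈ P → NonEmpty (pInt τ′ q) → pInt τ q ⊆ pInt τ′ q → pInt τ′ q ⊆ pInt τ q
      maximal τ′ τ′∈P _ τ⊆τ′ ∞      e = e
      maximal τ′ τ′∈P _ τ⊆τ′ (ix j) e with j <? N
      ... | yes j<N = sym (δ-one (trans (sumBelow-tight N (λ j → δ-mono (τ⊆τ′ (ix j)))
                                           (τ-largest τ′ τ′∈P (τ⊆τ′ (ix t) τt≡q)) j j<N)
                                        (δ-yes (sym e))))
      ... | no  j≮N = trans (at-beyond τ (≤-trans (P≤N τ τ∈P) (≮⇒≥ j≮N)))
                            (trans (sym (at-beyond τ′ (≤-trans (P≤N τ′ τ′∈P) (≮⇒≥ j≮N)))) e)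

    positionCovered : ∀ {α} → α ∈ P → ∀ t →
                      Σ Step λ { (q , a , b) → (q , a , b) ∈ S × at α t ≡ q × Interval a b (ix t) }
    positionCovered {α} α∈P t with largest (at α t) t α∈P refl
    ... | τ , τ∈P , τt≡q , τ-largest
      with proj₁ (profile (at α t) (pInt τ (at α t))) (largest-inProfile τ∈P τt≡q τ-largest)
    ... | (q , a , b) , s∈S , refl , (τ⊆ab , _) = (q , a , b) , s∈S , refl , τ⊆ab (ix t) τt≡q

    module _ (μ : List ℕ) {v} (μ-Dsc : Dsc v μ) (μ≤N : length μ ≤ N) where
      open StairList μ

      upper : ∀ {lo hi m α} → Stairs lo hi S → m ≢ 0 → reach S ≤ N → α ∈ P →
              mult m (μ ⊕ α) ≤ mult m (stairList S)
      upper {m = m} {α} stairs m≢0 reach≤N α∈P =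
        subst₂ _≤_ (sym (mult-⊕ m≢0 μ α μ≤N (P≤N α α∈P)))
                   (sym (mult-stairList stairs m≢0 reach≤N μ≤N))
                   (sumBelow-mono N covered)
        where
        covered : ∀ t → δ m (at μ t + at α t) ≤ stairCount S m t
        covered t with positionCovered α∈P t
        ... | (q , a , b) , s∈S , refl , t∈ab =
          ≤-trans (≤-reflexive (sym (stepCount-in q a b m t t∈ab)))
                  (∈⇒≤sum (∈-map⁺ (λ s → stepCount s m t) s∈S))

      realised : ∀ {m σ p a b} L → m ≢ 0 → σ ∈ P → (∀ i → Interval a b i → val σ i ≡ p) →
                 mult m L ≡ sumBelow (stepCount (p , a , b) m) N → mult m L ≤ mult m (μ ⊕ σ)
      realised {m} {σ} L m≢0 σ∈P σ≡p L≡ =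
        subst₂ _≤_ (sym L≡) (sym (mult-⊕ m≢0 μ σ μ≤N (P≤N σ σ∈P)))
                   (sumBelow-mono N (stepCount-realised σ σ≡p m))

      -- Lower bound: all m's of stairList μ S′ come from the first block whose
      -- values are not all above m, and that block is realised by some σ ∈ P.
      lower : ∀ {lo hi S′ m} → Stairs lo hi S′ → (∀ {s} → s ∈ S′ → s ∈ S) → reach S′ ≤ N → m ≢ 0 →
              ∃ λ σ → σ ∈ P × mult m (stairList S′) ≤ mult m (μ ⊕ σ)
      lower (final {a} _ _) sub a≤N m≢0 with stepRealised (sub (here refl))
      ... | σ , σ∈P , σ≡0 = σ , σ∈P , realised (drop a μ) m≢0 σ∈P σ≡0 (mult-tail m≢0 a≤N μ≤N)
      lower {m = m} (step {p} {a} {b} {S′} _ a≤b _ _ rest) sub reach≤N m≢0 with m <? at μ b + p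
      ... | yes m<min with lower rest (λ s∈ → sub (there s∈)) (≤-trans (m≤n+m _ _) reach≤N) m≢0
      ...   | σ , σ∈P , rest≤ = σ , σ∈P , subst (_≤ _) (sym onlyRest) rest≤
        where
        onlyRest : mult m (block p a b ++ stairList S′) ≡ mult m (stairList S′)
        onlyRest = trans (mult-++ m (block p a b) (stairList S′))
                         (cong (_+ mult m (stairList S′)) (mult-block-below μ-Dsc a≤b m<min))
      lower {m = m} (step {p} {a} {b} {S′} _ a≤b _ _ rest) sub reach≤N m≢0 | no m≮min
        with stepRealised (sub (here refl))
      ... | σ , σ∈P , σ≡p = σ , σ∈P , subst (_≤ _) (sym onlyBlock)
              (realised (block p a b) m≢0 σ∈P σ≡p (mult-block m a≤b (≤-trans (m≤m+n _ _) reach≤N)))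
        where
        onlyBlock : mult m (block p a b ++ stairList S′) ≡ mult m (block p a b)
        onlyBlock = trans (mult-++ m (block p a b) (stairList S′))
                          (trans (cong (mult m (block p a b) +_) (mult-stairList-above μ-Dsc rest (≮⇒≥ m≮min)))
                                 (+-identityʳ _))

veeP≡stairList : ∀ P S → ProfileIs P S → ∀ {lo hi} → Stairs lo hi S →
                 ∀ μ → IsPartition μ → veeP P μ ≡ StairList.stairList μ S
veeP≡stairList P S profile stairs μ μ-partition =
  Dsc-unique (veeP P μ) (stairList S) (proj₂ (veeP-Dsc P μ)) (stairList-Dsc μ-Dsc stairs)
             (veeP-pos P μ) (stairList-pos stairs (proj₂ μ-partition)) sameMult
  where
  open StairList μ
  open Profile P S profile
  N : ℕ
  N = length μ + (sum (map length P) + reach S)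
  P≤N : ∀ τ → τ ∈ P → length τ ≤ N
  P≤N τ τ∈P = ≤-trans (∈⇒≤sum (∈-map⁺ length τ∈P)) (≤-trans (m≤m+n _ (reach S)) (m≤n+m _ (length μ)))
  reach≤N : reach S ≤ N
  reach≤N = ≤-trans (m≤n+m _ _) (m≤n+m _ (length μ))
  μ-Dsc : Dsc (at μ 0) μ
  μ-Dsc = partition-Dsc μ-partition
  open Bounded N P≤N
  sameMult : ∀ m → m ≢ 0 → mult m (veeP P μ) ≡ mult m (stairList S)
  sameMult m m≢0 with lower μ μ-Dsc (m≤m+n _ _) stairs (λ s∈ → s∈) reach≤N m≢0
  ... | σ , σ∈P , stair≤σ = ≤-antisym
    (veeP-least P μ m≢0 (λ α α∈P → upper μ μ-Dsc (m≤m+n _ _) stairs m≢0 reach≤N α∈P))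
    (≤-trans stair≤σ (veeP-upper P μ m≢0 σ∈P))

lemma5p2 : (P : List (List ℕ)) → P ≢ [] → All IsPartition P →
           (S : List Step) → IsStaircase S → ProfileIs P S →
           (μ : List ℕ) → IsPartition μ →
           (∀ t → at (veeP P μ) t ≡ stairSeq S μ t)
           × weight (veeP P μ) ≡ stairWeight S μ
lemma5p2 P _ _ S staircase profile μ μ-partition =
  (λ t → trans (cong (λ L → at L t) veeP≡) (sym (stairSeq-stairList stairs t))) ,
  trans (cong sum veeP≡) (stairWeight-stairList stairs)
  where
  open StairList μ
  normalForm : ∃ λ hi → Stairs 0 hi S
  normalForm = Profile.staircase-Stairs P S profile staircase
  stairs : Stairs 0 (proj₁ normalForm) S
  stairs = proj₂ normalForm
  veeP≡ : veeP P μ ≡ stairList S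
  veeP≡ = veeP≡stairList P S profile stairs μ μ-partition
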